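{- Let $\lambda$ be a nonzero real number. For every integer $n\ge 0$, \[ \beta_{n,\lambda}=\sum_{k=0}^{n}(-1)^{k}k!\,{n \brace k}_{\lambda}\frac{\binom{k-\lambda}{k}}{k+1}. \]
   Context: For $x$ and an integer $n\ge0$, set $(x)_{0,\lambda}=1$, $(x)_{n,\lambda}=x(x-\lambda)\cdots(x-(n-1)\lambda)$ for $n\ge1$, and $(x)_0=1$, $(x)_n=x(x-1)\cdots(x-n+1)$ for $n\ge1$. The degenerate exponential is the power series $e_{\lambda}^{x}(t)=\sum_{k\ge0}(x)_{k,\lambda}\frac{t^k}{k!}$ (so $e_\lambda^x(t)=(1+\lambda t)^{x/\lambda}$), and $e_\lambda(t)=e_\lambda^1(t)$. The degenerate Stirling numbers of the second kind ${n \brace k}_{\lambda}$ are defined by $(x)_{n,\lambda}=\sum_{k=0}^{n}{n \brace k}_{\lambda}(x)_{k}$ for $n\ge0$; equivalently $\frac{1}{k!}(e_\lambda(t)-1)^k=\sum_{n\ge k}{n \brace k}_\lambda\frac{t^n}{n!}$. The degenerate Bernoulli numbers $\beta_{n,\lambda}$ are defined by $\frac{t}{e_{\lambda}(t)-1}=\sum_{n\ge0}\beta_{n,\lambda}\frac{t^{n}}{n!}$. Here $\binom{k-\lambda}{k}=(k-\lambda)_k/k!$. -}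

module Defs where

open import Level using (_⊔_) renaming (suc to lsuc)
open import Data.Nat using (ℕ; zero; suc; _∸_) renaming (_+_ to _+ℕ_)
open import Data.Nat.Combinatorics using (_C_)
open import Data.Nat using (_!)
open import Algebra.Bundles using (CommutativeRing)
open import Relation.Nullary using (¬_)

-- A field of characteristic zero (abstract stand-in for ℝ), presented as a
-- commutative ring with a total inverse operation that is a genuine inverse
-- on nonzero elements, and such that (n+1)·1 ≠ 0 for all n.
-- canonical image of a natural number in a ring: n ↦ 1 + 1 + ... + 1 (n times)
ιR : ∀ {c ℓ} (R : CommutativeRing c ℓ) → ℕ → CommutativeRing.Carrier R
ιR R zero    = CommutativeRing.0# R
ιR R (suc n) = CommutativeRing._+_ R (CommutativeRing.1# R) (ιR R n)

record CharZeroField c ℓ : Set (lsuc (c ⊔ ℓ)) where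
  field
    commutativeRing : CommutativeRing c ℓ
  open CommutativeRing commutativeRing public
  field
    _⁻¹      : Carrier → Carrier
    inverseʳ : ∀ x → ¬ (x ≈ 0#) → (x * (x ⁻¹)) ≈ 1#

    char0    : ∀ n → ¬ (ιR commutativeRing (suc n) ≈ 0#)

  ι : ℕ → Carrier
  ι = ιR commutativeRing

module Degenerate {c ℓ} (F : CharZeroField c ℓ) where
  open CharZeroField F

  infixr 8 _^_
  _^_ : Carrier → ℕ → Carrier
  x ^ zero  = 1#
  x ^ suc n = x * (x ^ n)

  fallλ : Carrier → Carrier → ℕ → Carrier
  fallλ lam x zero    = 1#
  fallλ lam x (suc n) = fallλ lam x n * (x - ι n * lam)

  fall : Carrier → ℕ → Carrier
  fall x n = fallλ 1# x n

  sumTo : ℕ → (ℕ → Carrier) → Carrier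
  sumTo zero    f = f 0
  sumTo (suc n) f = sumTo n f + f (suc n)

  -- formal power series in t, represented by their exponential coefficients:
  -- a represents Σ_n a n · t^n / n!
  Series : Set c
  Series = ℕ → Carrier

  _⊛_ : Series → Series → Series
  (a ⊛ b) n = sumTo n (λ j → ι (n C j) * (a j * b (n ∸ j)))

  oneS : Series
  oneS zero    = 1#
  oneS (suc n) = 0#

  tS : Series
  tS (suc zero) = 1#
  tS _          = 0#

  eλ : Carrier → Series
  eλ lam k = fallλ lam 1# k

  eλ-1 : Carrier → Series
  eλ-1 lam zero    = 0#
  eλ-1 lam (suc k) = eλ lam (suc k)

  powS : Series → ℕ → Series
  powS s zero    = oneS
  powS s (suc k) = s ⊛ powS s k

  S₂λ : Carrier → ℕ → ℕ → Carrier
  S₂λ lam n k = (ι (k !) ⁻¹) * powS (eλ-1 lam) k n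

  -- β is the sequence of degenerate Bernoulli numbers:
  -- t / (e_λ(t) - 1) = Σ β n t^n / n!, i.e. (Σ β n t^n/n!)·(e_λ(t) - 1) = t
  IsDegBernoulli : Carrier → (ℕ → Carrier) → Set ℓ
  IsDegBernoulli lam β = ∀ n → (β ⊛ eλ-1 lam) n ≈ tS n

  binomλ : Carrier → ℕ → Carrier
  binomλ lam k = fall (ι k - lam) k * (ι (k !) ⁻¹)

  rhs : Carrier → ℕ → Carrier
  rhs lam n = sumTo n (λ k →
    ((- 1#) ^ k) * (ι (k !) * (S₂λ lam n k * (binomλ lam k * (ι (suc k) ⁻¹)))))

{-# OPTIONS --safe #-}
module Submission where

-- Let u = e_λ(t) - 1, so that uᵏ = k! Σₙ S_λ(n, k) tⁿ/n!. Since (1 + λt) u′ = 1 + u,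
-- applying (1 + λt) d/dt to uᵏ gives the recurrence of the S_λ(n, k), and from it
-- Σₖ binom(x, k) uᵏ = e_λ^x(t), i.e. (x)_{n,λ} = Σₖ S_λ(n, k) (x)_k. The right-hand
-- side of the theorem is the coefficient sequence of Σₖ cₖ uᵏ, where upper negation
-- and absorption give λ cₖ = binom(λ, k + 1). Hence
-- λ · rhs · u = Σ_{k ≥ 1} binom(λ, k) uᵏ = e_λ^λ(t) - 1 = λt, so rhs · u = t = β · u,
-- and a series a is determined by a · u because u = t + O(t²).

open import Defs
open import Algebra.Bundles using (CommutativeRing)
open import Algebra.Solver.Ring.AlmostCommutativeRing
  using (_-Raw-AlmostCommutative⟶_; fromCommutativeRing)
open import Data.Empty using (⊥-elim)
open import Data.Integer as ℤ using (ℤ; +_; -[1+_])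
import Data.Integer.Properties as ℤ
open import Data.Maybe using (Maybe; just; nothing)
open import Data.Nat as ℕ
  using (ℕ; zero; suc; _!; _∸_; _≤_; _<_; _≤′_; ≤′-refl; ≤′-step; z≤n; s≤s)
open import Data.Nat.Combinatorics
  using (_C_; nCk≡nC[n∸k]; nC1≡n; k>n⇒nCk≡0; nCk+nC[k+1]≡[n+1]C[k+1])
open import Data.Nat.Induction using (<-rec)
import Data.Nat.Properties as ℕ
open import Data.Sign as Sign using (Sign)
open import Data.Sum using (inj₁; inj₂)
open import Function using (_∘_)
open import Relation.Binary.PropositionalEquality as ≡ using (_≡_; _≢_)
open import Relation.Nullary using (¬_; yes; no)

module IntegerCoefficients {c ℓ} (R : CommutativeRing c ℓ) where
  open CommutativeRing R
  open import Algebra.Properties.Ring ring using (-0#≈0#; -‿involutive; -‿+-comm; -1*x≈-x; -‿distribʳ-*)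
  open import Algebra.Properties.CommutativeSemigroup +-commutativeSemigroup using (interchange)
  open import Algebra.Properties.CommutativeSemigroup *-commutativeSemigroup
    using () renaming (interchange to *-interchange)
  open import Relation.Binary.Reasoning.Setoid setoid

  private
    ι : ℕ → Carrier
    ι = ιR R

  ι-+ : ∀ m n → ι (m ℕ.+ n) ≈ ι m + ι n
  ι-+ zero    n = sym (+-identityˡ _)
  ι-+ (suc m) n = trans (+-congˡ (ι-+ m n)) (sym (+-assoc _ _ _))

  ι-* : ∀ m n → ι (m ℕ.* n) ≈ ι m * ι n
  ι-* zero    n = sym (zeroˡ _)
  ι-* (suc m) n = begin
    ι (n ℕ.+ m ℕ.* n)      ≈⟨ trans (ι-+ n (m ℕ.* n)) (+-cong (sym (*-identityˡ _)) (ι-* m n)) ⟩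
    1# * ι n + ι m * ι n   ≈⟨ distribʳ _ _ _ ⟨
    (1# + ι m) * ι n       ∎

  -- unlike ι 1 = 1# + 0#, ι′ 1 is 1# itself, so that the solver's constant con (+ 1)
  -- is definitionally the 1# occurring in goals
  ι′ : ℕ → Carrier
  ι′ zero          = 0#
  ι′ (suc zero)    = 1#
  ι′ (suc (suc n)) = 1# + ι′ (suc n)

  ι′≈ι : ∀ n → ι′ n ≈ ι n
  ι′≈ι zero          = refl
  ι′≈ι (suc zero)    = sym (+-identityʳ 1#)
  ι′≈ι (suc (suc n)) = +-congˡ (ι′≈ι (suc n))

  ι′-suc : ∀ n → ι′ (suc n) ≈ 1# + ι′ n
  ι′-suc n = trans (ι′≈ι (suc n)) (+-congˡ (sym (ι′≈ι n)))

  ι′-+ : ∀ m n → ι′ (m ℕ.+ n) ≈ ι′ m + ι′ n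
  ι′-+ m n = trans (ι′≈ι (m ℕ.+ n)) (trans (ι-+ m n) (sym (+-cong (ι′≈ι m) (ι′≈ι n))))

  ι′-* : ∀ m n → ι′ (m ℕ.* n) ≈ ι′ m * ι′ n
  ι′-* m n = trans (ι′≈ι (m ℕ.* n)) (trans (ι-* m n) (sym (*-cong (ι′≈ι m) (ι′≈ι n))))

  ⟦_⟧ : ℤ → Carrier
  ⟦ + n ⟧      = ι′ n
  ⟦ -[1+ n ] ⟧ = - ι′ (suc n)

  ⊖-homo : ∀ m n → ⟦ m ℤ.⊖ n ⟧ ≈ ι′ m - ι′ n
  ⊖-homo m       zero    = sym (trans (+-congˡ -0#≈0#) (+-identityʳ _))
  ⊖-homo zero    (suc n) = sym (+-identityˡ _)
  ⊖-homo (suc m) (suc n) = begin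
    ⟦ suc m ℤ.⊖ suc n ⟧           ≡⟨ ≡.cong ⟦_⟧ (ℤ.[1+m]⊖[1+n]≡m⊖n m n) ⟩
    ⟦ m ℤ.⊖ n ⟧                   ≈⟨ ⊖-homo m n ⟩
    ι′ m - ι′ n                   ≈⟨ +-identityˡ _ ⟨
    0# + (ι′ m - ι′ n)            ≈⟨ +-congʳ (-‿inverseʳ 1#) ⟨
    (1# - 1#) + (ι′ m - ι′ n)     ≈⟨ interchange _ _ _ _ ⟨
    (1# + ι′ m) + (- 1# - ι′ n)   ≈⟨ +-congˡ (-‿+-comm 1# (ι′ n)) ⟩
    (1# + ι′ m) - (1# + ι′ n)     ≈⟨ +-cong (ι′-suc m) (-‿cong (ι′-suc n)) ⟨
    ι′ (suc m) - ι′ (suc n)       ∎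

  +-homo : ∀ i j → ⟦ i ℤ.+ j ⟧ ≈ ⟦ i ⟧ + ⟦ j ⟧
  +-homo (+ m)      (+ n)      = ι′-+ m n
  +-homo (+ m)      -[1+ n ]   = ⊖-homo m (suc n)
  +-homo -[1+ m ]   (+ n)      = trans (⊖-homo n (suc m)) (+-comm _ _)
  +-homo -[1+ m ]   -[1+ n ]   = begin
    - ι′ (suc (suc (m ℕ.+ n)))       ≡⟨ ≡.cong (λ k → - ι′ (suc k)) (ℕ.+-suc m n) ⟨
    - ι′ (suc m ℕ.+ suc n)           ≈⟨ -‿cong (ι′-+ (suc m) (suc n)) ⟩
    - (ι′ (suc m) + ι′ (suc n))      ≈⟨ -‿+-comm _ _ ⟨
    - ι′ (suc m) + - ι′ (suc n)      ∎

  -‿homo : ∀ i → ⟦ ℤ.- i ⟧ ≈ - ⟦ i ⟧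
  -‿homo (+ zero)   = sym -0#≈0#
  -‿homo (+ suc n)  = refl
  -‿homo -[1+ n ]   = sym (-‿involutive _)

  ⟦_⟧ₛ : Sign → Carrier
  ⟦ Sign.+ ⟧ₛ = 1#
  ⟦ Sign.- ⟧ₛ = - 1#

  ◃-homo : ∀ s n → ⟦ s ℤ.◃ n ⟧ ≈ ⟦ s ⟧ₛ * ι′ n
  ◃-homo s        zero    = sym (zeroʳ _)
  ◃-homo Sign.+   (suc n) = sym (*-identityˡ _)
  ◃-homo Sign.-   (suc n) = sym (-1*x≈-x _)

  sign-*-homo : ∀ s t → ⟦ s Sign.* t ⟧ₛ ≈ ⟦ s ⟧ₛ * ⟦ t ⟧ₛ
  sign-*-homo Sign.+ t      = sym (*-identityˡ _)
  sign-*-homo Sign.- Sign.+ = sym (*-identityʳ _)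
  sign-*-homo Sign.- Sign.- = begin
    1#                ≈⟨ -‿involutive 1# ⟨
    - - 1#            ≈⟨ -‿cong (-1*x≈-x 1#) ⟨
    - (- 1# * 1#)     ≈⟨ -‿distribʳ-* _ _ ⟩
    - 1# * - 1#       ∎

  *-homo : ∀ i j → ⟦ i ℤ.* j ⟧ ≈ ⟦ i ⟧ * ⟦ j ⟧
  *-homo i j = begin
    ⟦ (s Sign.* t) ℤ.◃ (m ℕ.* n) ⟧        ≈⟨ ◃-homo (s Sign.* t) (m ℕ.* n) ⟩
    ⟦ s Sign.* t ⟧ₛ * ι′ (m ℕ.* n)         ≈⟨ *-cong (sign-*-homo s t) (ι′-* m n) ⟩
    (⟦ s ⟧ₛ * ⟦ t ⟧ₛ) * (ι′ m * ι′ n)      ≈⟨ *-interchange _ _ _ _ ⟩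
    (⟦ s ⟧ₛ * ι′ m) * (⟦ t ⟧ₛ * ι′ n)      ≈⟨ *-cong (◃-homo s m) (◃-homo t n) ⟨
    ⟦ s ℤ.◃ m ⟧ * ⟦ t ℤ.◃ n ⟧
      ≡⟨ ≡.cong₂ (λ i′ j′ → ⟦ i′ ⟧ * ⟦ j′ ⟧) (ℤ.◃-inverse i) (ℤ.◃-inverse j) ⟩
    ⟦ i ⟧ * ⟦ j ⟧                          ∎
    where
    s = ℤ.sign i
    t = ℤ.sign j
    m = ℤ.∣ i ∣
    n = ℤ.∣ j ∣

  homomorphism : ℤ.+-*-rawRing -Raw-AlmostCommutative⟶ fromCommutativeRing R
  homomorphism = record
    { ⟦_⟧    = ⟦_⟧
    ; +-homo = +-homo
    ; *-homo = *-homo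
    ; -‿homo = -‿homo
    ; 0-homo = refl
    ; 1-homo = refl
    }

  coefficient≟ : ∀ i j → Maybe (⟦ i ⟧ ≈ ⟦ j ⟧)
  coefficient≟ i j with i ℤ.≟ j
  ... | yes ≡.refl = just refl
  ... | no _       = nothing

  open import Algebra.Solver.Ring ℤ.+-*-rawRing (fromCommutativeRing R) homomorphism coefficient≟
    public using (solve; _:=_; _:+_; _:*_; _:-_; :-_; con)


module DegenerateSeries {c ℓ} (F : CharZeroField c ℓ) where
  open CharZeroField F
  open Degenerate F
  open IntegerCoefficients commutativeRing using (ι-+; ι-*; solve; _:=_; _:+_; _:*_; _:-_; :-_; con)
  open import Algebra.Properties.Ring ring using (+-cancelˡ; x∙y⁻¹≈ε⇒x≈y; -1*x≈-x)
  open import Algebra.Properties.CommutativeSemigroup +-commutativeSemigroup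
    using () renaming (interchange to +-interchange; x∙yz≈y∙xz to x+[y+z]≈y+[x+z])
  open import Algebra.Properties.CommutativeSemigroup *-commutativeSemigroup
    using (x∙yz≈y∙xz; x∙yz≈xz∙y)
  open import Relation.Binary.Reasoning.Setoid setoid

  x[x⁻¹y]≈y : ∀ {x} → ¬ x ≈ 0# → ∀ y → x * (x ⁻¹ * y) ≈ y
  x[x⁻¹y]≈y {x} x≉0 y = begin
    x * (x ⁻¹ * y)  ≈⟨ *-assoc x (x ⁻¹) y ⟨
    x * x ⁻¹ * y    ≈⟨ *-congʳ (inverseʳ x x≉0) ⟩
    1# * y          ≈⟨ *-identityˡ y ⟩
    y               ∎

  *-cancelˡ : ∀ {x} → ¬ x ≈ 0# → ∀ {y z} → x * y ≈ x * z → y ≈ z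
  *-cancelˡ {x} x≉0 {y} {z} xy≈xz = begin
    y               ≈⟨ x[x⁻¹y]≈y x≉0 y ⟨
    x * (x ⁻¹ * y)  ≈⟨ x∙yz≈y∙xz x (x ⁻¹) y ⟩
    x ⁻¹ * (x * y)  ≈⟨ *-congˡ xy≈xz ⟩
    x ⁻¹ * (x * z)  ≈⟨ x∙yz≈y∙xz (x ⁻¹) x z ⟩
    x * (x ⁻¹ * z)  ≈⟨ x[x⁻¹y]≈y x≉0 z ⟩
    z               ∎

  y≈0⇒x*y≈0 : ∀ x {y} → y ≈ 0# → x * y ≈ 0#
  y≈0⇒x*y≈0 x y≈0 = trans (*-congˡ y≈0) (zeroʳ x)

  x≈0⇒x*y≈0 : ∀ {x} y → x ≈ 0# → x * y ≈ 0#
  x≈0⇒x*y≈0 y x≈0 = trans (*-congʳ x≈0) (zeroˡ y)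

  ι[n!]≉0 : ∀ n → ¬ ι (n !) ≈ 0#
  ι[n!]≉0 n with n ! | ℕ.1≤n! n
  ... | suc m | _ = char0 m

  fall-cong : ∀ {x y} k → x ≈ y → fall x k ≈ fall y k
  fall-cong zero    x≈y = refl
  fall-cong (suc k) x≈y = *-cong (fall-cong k x≈y) (+-congʳ x≈y)

  fall-suc : ∀ x k → fall x (suc k) ≈ x * fall (x - 1#) k
  fall-suc x zero    = solve 1 (λ x → con (+ 1) :* (x :- con (+ 0) :* con (+ 1)) := x :* con (+ 1)) refl x
  fall-suc x (suc k) = begin
    fall x (suc k) * (x - ι (suc k) * 1#)        ≈⟨ *-congʳ (fall-suc x k) ⟩
    x * fall (x - 1#) k * (x - ι (suc k) * 1#)
      ≈⟨ solve 3 (λ x F k → x :* F :* (x :- (con (+ 1) :+ k) :* con (+ 1))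
                         := x :* (F :* ((x :- con (+ 1)) :- k :* con (+ 1))))
               refl x (fall (x - 1#) k) (ι k) ⟩
    x * fall (x - 1#) (suc k)                    ∎

  fall-negate-upper : ∀ y k → (- 1#) ^ k * fall (ι k - y) k ≈ fall (y - 1#) k
  fall-negate-upper y zero    = *-identityˡ 1#
  fall-negate-upper y (suc k) = begin
    (- 1# * (- 1#) ^ k) * fall (ι (suc k) - y) (suc k)
      ≈⟨ *-congˡ (fall-suc _ k) ⟩
    (- 1# * (- 1#) ^ k) * ((ι (suc k) - y) * fall (ι (suc k) - y - 1#) k)
      ≈⟨ *-congˡ (*-congˡ (fall-cong k
           (solve 2 (λ k y → con (+ 1) :+ k :- y :- con (+ 1) := k :- y) refl (ι k) y))) ⟩
    (- 1# * (- 1#) ^ k) * ((ι (suc k) - y) * fall (ι k - y) k)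
      ≈⟨ solve 4 (λ s F k y → (:- con (+ 1) :* s) :* ((con (+ 1) :+ k :- y) :* F)
                           := (s :* F) :* ((y :- con (+ 1)) :- k :* con (+ 1)))
               refl ((- 1#) ^ k) (fall (ι k - y) k) (ι k) y ⟩
    ((- 1#) ^ k * fall (ι k - y) k) * (y - 1# - ι k * 1#)
      ≈⟨ *-congʳ (fall-negate-upper y k) ⟩
    fall (y - 1#) (suc k) ∎

  binom : Carrier → ℕ → Carrier
  binom x k = fall x k * ι (k !) ⁻¹

  ι[k!]*binom : ∀ x k → ι (k !) * binom x k ≈ fall x k
  ι[k!]*binom x k = begin
    ι (k !) * (fall x k * ι (k !) ⁻¹)  ≈⟨ x∙yz≈y∙xz _ _ _ ⟩
    fall x k * (ι (k !) * ι (k !) ⁻¹)  ≈⟨ *-congˡ (inverseʳ _ (ι[n!]≉0 k)) ⟩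
    fall x k * 1#                      ≈⟨ *-identityʳ _ ⟩
    fall x k                           ∎

  ι[k!]*ι[1+k]*binom : ∀ x k → ι (k !) * (ι (suc k) * binom x (suc k)) ≈ fall x (suc k)
  ι[k!]*ι[1+k]*binom x k = begin
    ι (k !) * (ι (suc k) * binom x (suc k))  ≈⟨ x∙yz≈y∙xz _ _ _ ⟩
    ι (suc k) * (ι (k !) * binom x (suc k))  ≈⟨ *-assoc _ _ _ ⟨
    ι (suc k) * ι (k !) * binom x (suc k)    ≈⟨ *-congʳ (ι-* (suc k) (k !)) ⟨
    ι (suc k !) * binom x (suc k)            ≈⟨ ι[k!]*binom x (suc k) ⟩
    fall x (suc k)                           ∎

  binom-zero : ∀ x → binom x 0 ≈ 1#
  binom-zero x = *-cancelˡ (char0 0) (trans (ι[k!]*binom x 0) (sym (trans (*-identityʳ _) (+-identityʳ 1#))))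

  binom-suc : ∀ x k → ι (suc k) * binom x (suc k) ≈ binom x k * (x - ι k)
  binom-suc x k = *-cancelˡ (ι[n!]≉0 k) (begin
    ι (k !) * (ι (suc k) * binom x (suc k))  ≈⟨ ι[k!]*ι[1+k]*binom x k ⟩
    fall x k * (x - ι k * 1#)
      ≈⟨ *-cong (ι[k!]*binom x k) (+-congˡ (-‿cong (sym (*-identityʳ _)))) ⟨
    ι (k !) * binom x k * (x - ι k)          ≈⟨ *-assoc _ _ _ ⟩
    ι (k !) * (binom x k * (x - ι k))        ∎)

  binom-absorb : ∀ x k → ι (suc k) * binom x (suc k) ≈ x * binom (x - 1#) k
  binom-absorb x k = *-cancelˡ (ι[n!]≉0 k) (begin
    ι (k !) * (ι (suc k) * binom x (suc k))  ≈⟨ ι[k!]*ι[1+k]*binom x k ⟩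
    fall x (suc k)                           ≈⟨ fall-suc x k ⟩
    x * fall (x - 1#) k                      ≈⟨ *-congˡ (ι[k!]*binom _ k) ⟨
    x * (ι (k !) * binom (x - 1#) k)         ≈⟨ x∙yz≈y∙xz _ _ _ ⟩
    ι (k !) * (x * binom (x - 1#) k)         ∎)

  binom-negate-upper : ∀ y k → (- 1#) ^ k * binom (ι k - y) k ≈ binom (y - 1#) k
  binom-negate-upper y k = trans (sym (*-assoc _ _ _)) (*-congʳ (fall-negate-upper y k))

  sumTo-cong : ∀ n {f g : ℕ → Carrier} → (∀ i → i ≤ n → f i ≈ g i) → sumTo n f ≈ sumTo n g
  sumTo-cong zero    f≈g = f≈g 0 z≤n
  sumTo-cong (suc n) f≈g =
    +-cong (sumTo-cong n (λ i i≤n → f≈g i (ℕ.m≤n⇒m≤1+n i≤n))) (f≈g (suc n) ℕ.≤-refl)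

  sumTo-zero : ∀ n {f : ℕ → Carrier} → (∀ i → i ≤ n → f i ≈ 0#) → sumTo n f ≈ 0#
  sumTo-zero n f≈0 = trans (sumTo-cong n f≈0) (sumTo-const0 n)
    where
    sumTo-const0 : ∀ n → sumTo n (λ _ → 0#) ≈ 0#
    sumTo-const0 zero    = refl
    sumTo-const0 (suc n) = trans (+-congʳ (sumTo-const0 n)) (+-identityʳ 0#)

  sumTo-+ : ∀ n (f g : ℕ → Carrier) → sumTo n (λ i → f i + g i) ≈ sumTo n f + sumTo n g
  sumTo-+ zero    f g = refl
  sumTo-+ (suc n) f g = trans (+-congʳ (sumTo-+ n f g)) (+-interchange _ _ _ _)

  sumTo-*ˡ : ∀ n x (f : ℕ → Carrier) → x * sumTo n f ≈ sumTo n (λ i → x * f i)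
  sumTo-*ˡ zero    x f = refl
  sumTo-*ˡ (suc n) x f = trans (distribˡ x _ _) (+-congʳ (sumTo-*ˡ n x f))

  sumTo-suc : ∀ n (f : ℕ → Carrier) → sumTo (suc n) f ≈ f 0 + sumTo n (f ∘ suc)
  sumTo-suc zero    f = refl
  sumTo-suc (suc n) f = trans (+-congʳ (sumTo-suc n f)) (+-assoc _ _ _)

  sumTo-shift : ∀ n {f : ℕ → Carrier} → f (suc n) ≈ 0# → f 0 + sumTo n (f ∘ suc) ≈ sumTo n f
  sumTo-shift n {f} f[1+n]≈0 = begin
    f 0 + sumTo n (f ∘ suc)  ≈⟨ sumTo-suc n f ⟨
    sumTo n f + f (suc n)    ≈⟨ +-congˡ f[1+n]≈0 ⟩
    sumTo n f + 0#           ≈⟨ +-identityʳ _ ⟩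
    sumTo n f                ∎

  sumTo-extend : ∀ {m n} (f : ℕ → Carrier) → m ≤ n → (∀ i → m < i → f i ≈ 0#) →
                 sumTo n f ≈ sumTo m f
  sumTo-extend {m} f m≤n f≈0 = go (ℕ.≤⇒≤′ m≤n)
    where
    go : ∀ {n} → m ≤′ n → sumTo n f ≈ sumTo m f
    go ≤′-refl        = refl
    go (≤′-step m≤′n) = trans (+-cong (go m≤′n) (f≈0 _ (s≤s (ℕ.≤′⇒≤ m≤′n)))) (+-identityʳ _)

  sumTo-swap : ∀ m n (f : ℕ → ℕ → Carrier) →
               sumTo m (λ i → sumTo n (f i)) ≈ sumTo n (λ j → sumTo m (λ i → f i j))
  sumTo-swap zero    n f = refl
  sumTo-swap (suc m) n f = trans (+-congʳ (sumTo-swap m n f)) (sym (sumTo-+ n _ _))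

  sumTo-reverse : ∀ n (f : ℕ → Carrier) → sumTo n f ≈ sumTo n (λ i → f (n ∸ i))
  sumTo-reverse zero    f = refl
  sumTo-reverse (suc n) f = begin
    sumTo n f + f (suc n)                         ≈⟨ +-comm _ _ ⟩
    f (suc n) + sumTo n f                         ≈⟨ +-congˡ (sumTo-reverse n f) ⟩
    f (suc n) + sumTo n (λ i → f (suc n ∸ suc i)) ≈⟨ sumTo-suc n (λ i → f (suc n ∸ i)) ⟨
    sumTo (suc n) (λ i → f (suc n ∸ i))           ∎

  sumTo-single : ∀ N {n} (f : ℕ → Carrier) → n ≤ N → (∀ j → j ≤ N → j ≢ n → f j ≈ 0#) →
                 sumTo N f ≈ f n
  sumTo-single zero    f z≤n _ = refl
  sumTo-single (suc N) {n} f n≤1+N f≈0 with n ℕ.≟ suc N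
  ... | yes ≡.refl = begin
    sumTo N f + f (suc N)
      ≈⟨ +-congʳ (sumTo-zero N (λ j j≤N → f≈0 j (ℕ.m≤n⇒m≤1+n j≤N) (ℕ.<⇒≢ (s≤s j≤N)))) ⟩
    0# + f (suc N)        ≈⟨ +-identityˡ _ ⟩
    f (suc N)             ∎
  ... | no n≢1+N = begin
    sumTo N f + f (suc N)
      ≈⟨ +-cong (sumTo-single N f n≤N (λ j j≤N → f≈0 j (ℕ.m≤n⇒m≤1+n j≤N)))
                (f≈0 (suc N) ℕ.≤-refl (n≢1+N ∘ ≡.sym)) ⟩
    f n + 0#              ≈⟨ +-identityʳ _ ⟩
    f n                   ∎
    where
    n≤N : n ≤ N
    n≤N = ℕ.≤-pred (ℕ.≤∧≢⇒< n≤1+N n≢1+N)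

  infix  4 _≐_
  infixl 6 _⊕_
  infixr 25 _·_

  _≐_ : Series → Series → Set ℓ
  a ≐ b = ∀ n → a n ≈ b n

  _⊕_ : Series → Series → Series
  (a ⊕ b) n = a n + b n

  _·_ : Carrier → Series → Series
  (x · a) n = x * a n

  -- d/dt and t d/dt, acting on exponential coefficients
  D θ : Series → Series
  D a n = a (suc n)
  θ a n = ι n * a n

  θ-oneS : ∀ n → θ oneS n ≈ 0#
  θ-oneS zero    = zeroˡ 1#
  θ-oneS (suc n) = zeroʳ _

  ⊛-congˡ : ∀ a {b b′} → b ≐ b′ → a ⊛ b ≐ a ⊛ b′
  ⊛-congˡ a b≐b′ n = sumTo-cong n (λ j _ → *-congˡ (*-congˡ (b≐b′ (n ∸ j))))

  ⊛-congʳ : ∀ b {a a′} → a ≐ a′ → a ⊛ b ≐ a′ ⊛ b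
  ⊛-congʳ b a≐a′ n = sumTo-cong n (λ j _ → *-congˡ (*-congʳ (a≐a′ j)))

  ⊛-comm : ∀ a b → a ⊛ b ≐ b ⊛ a
  ⊛-comm a b n = trans (sumTo-reverse n _) (sumTo-cong n λ j j≤n → begin
    ι (n C (n ∸ j)) * (a (n ∸ j) * b (n ∸ (n ∸ j)))
      ≡⟨ ≡.cong₂ (λ i k → ι i * (a (n ∸ j) * b k))
                 (≡.sym (nCk≡nC[n∸k] j≤n)) (ℕ.m∸[m∸n]≡n j≤n) ⟩
    ι (n C j) * (a (n ∸ j) * b j)  ≈⟨ *-congˡ (*-comm _ _) ⟩
    ι (n C j) * (b j * a (n ∸ j))  ∎)

  ⊛-identityˡ : ∀ a → oneS ⊛ a ≐ a
  ⊛-identityˡ a n = begin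
    (oneS ⊛ a) n               ≈⟨ sumTo-single n _ z≤n higher-terms ⟩
    ι 1 * (1# * a n)
      ≈⟨ solve 1 (λ x → (con (+ 1) :+ con (+ 0)) :* (con (+ 1) :* x) := x) refl (a n) ⟩
    a n                        ∎
    where
    higher-terms : ∀ j → j ≤ n → j ≢ 0 → ι (n C j) * (oneS j * a (n ∸ j)) ≈ 0#
    higher-terms zero    _ 0≢0 = ⊥-elim (0≢0 ≡.refl)
    higher-terms (suc j) _ _   = y≈0⇒x*y≈0 _ (zeroˡ _)

  ⊛-zeroʳ : ∀ a {b} → (∀ i → b i ≈ 0#) → ∀ n → (a ⊛ b) n ≈ 0#
  ⊛-zeroʳ a b≈0 n = sumTo-zero n (λ j _ → y≈0⇒x*y≈0 _ (y≈0⇒x*y≈0 _ (b≈0 (n ∸ j))))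

  ⊛-distribʳ : ∀ a b c → (a ⊕ b) ⊛ c ≐ (a ⊛ c) ⊕ (b ⊛ c)
  ⊛-distribʳ a b c n =
    trans (sumTo-cong n (λ j _ → trans (*-congˡ (distribʳ _ _ _)) (distribˡ _ _ _))) (sumTo-+ n _ _)

  ⊛-distribˡ : ∀ a b c → a ⊛ (b ⊕ c) ≐ (a ⊛ b) ⊕ (a ⊛ c)
  ⊛-distribˡ a b c n =
    trans (sumTo-cong n (λ j _ → trans (*-congˡ (distribˡ _ _ _)) (distribˡ _ _ _))) (sumTo-+ n _ _)

  ⊛-scaleˡ : ∀ x a b → (x · a) ⊛ b ≐ x · (a ⊛ b)
  ⊛-scaleˡ x a b n =
    trans (sumTo-cong n (λ j _ → trans (*-congˡ (*-assoc _ _ _)) (x∙yz≈y∙xz _ _ _))) (sym (sumTo-*ˡ n x _))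

  ⊛-scaleʳ : ∀ x a b → a ⊛ (x · b) ≐ x · (a ⊛ b)
  ⊛-scaleʳ x a b n =
    trans (sumTo-cong n (λ j _ → trans (*-congˡ (x∙yz≈y∙xz _ _ _)) (x∙yz≈y∙xz _ _ _)))
          (sym (sumTo-*ˡ n x _))

  ⊛-sumToʳ : ∀ a N (f : ℕ → Series) →
             a ⊛ (λ m → sumTo N (λ k → f k m)) ≐ λ n → sumTo N (λ k → (a ⊛ f k) n)
  ⊛-sumToʳ a N f n = begin
    sumTo n (λ j → ι (n C j) * (a j * sumTo N (λ k → f k (n ∸ j))))
      ≈⟨ sumTo-cong n (λ j _ → trans (*-congˡ (sumTo-*ˡ N (a j) _)) (sumTo-*ˡ N _ _)) ⟩
    sumTo n (λ j → sumTo N (λ k → ι (n C j) * (a j * f k (n ∸ j))))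
      ≈⟨ sumTo-swap n N _ ⟩
    sumTo N (λ k → (a ⊛ f k) n) ∎

  θ-⊛ : ∀ a b → θ (a ⊛ b) ≐ (θ a ⊛ b) ⊕ (a ⊛ θ b)
  θ-⊛ a b n = begin
    ι n * (a ⊛ b) n
      ≈⟨ sumTo-*ˡ n (ι n) _ ⟩
    sumTo n (λ j → ι n * (ι (n C j) * (a j * b (n ∸ j))))
      ≈⟨ sumTo-cong n split ⟩
    sumTo n (λ j → ι (n C j) * (θ a j * b (n ∸ j)) + ι (n C j) * (a j * θ b (n ∸ j)))
      ≈⟨ sumTo-+ n _ _ ⟩
    (θ a ⊛ b) n + (a ⊛ θ b) n ∎
    where
    split : ∀ j → j ≤ n → ι n * (ι (n C j) * (a j * b (n ∸ j)))
                          ≈ ι (n C j) * (θ a j * b (n ∸ j)) + ι (n C j) * (a j * θ b (n ∸ j))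
    split j j≤n = begin
      ι n * (ι (n C j) * (a j * b (n ∸ j)))
        ≡⟨ ≡.cong (λ m → ι m * (ι (n C j) * (a j * b (n ∸ j)))) (ℕ.m+[n∸m]≡n j≤n) ⟨
      ι (j ℕ.+ (n ∸ j)) * (ι (n C j) * (a j * b (n ∸ j)))
        ≈⟨ *-congʳ (ι-+ j (n ∸ j)) ⟩
      (ι j + ι (n ∸ j)) * (ι (n C j) * (a j * b (n ∸ j)))
        ≈⟨ solve 5 (λ p q c x y → (p :+ q) :* (c :* (x :* y)) := c :* (p :* x :* y) :+ c :* (x :* (q :* y)))
                 refl (ι j) (ι (n ∸ j)) (ι (n C j)) (a j) (b (n ∸ j)) ⟩
      ι (n C j) * (θ a j * b (n ∸ j)) + ι (n C j) * (a j * θ b (n ∸ j)) ∎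

  ⊛-D-expand : ∀ a b n →
    (a ⊛ D b) n ≈ ι 1 * (a 0 * b (suc n)) + sumTo n (λ j → ι (n C suc j) * (a (suc j) * b (n ∸ j)))
  ⊛-D-expand a b zero    = sym (trans (+-congˡ (zeroˡ _)) (+-identityʳ _))
  ⊛-D-expand a b (suc n) = begin
    (a ⊛ D b) (suc n)
      ≈⟨ sumTo-suc n _ ⟩
    ι 1 * (a 0 * b (suc (suc n))) + sumTo n (λ j → ι (suc n C suc j) * (a (suc j) * b (suc (n ∸ j))))
      ≈⟨ +-congˡ (sumTo-cong n (λ j j≤n → reflexive (≡.cong (λ i → ι (suc n C suc j) * (a (suc j) * b i))
                                                            (≡.sym (ℕ.+-∸-assoc 1 j≤n))))) ⟩
    ι 1 * (a 0 * b (suc (suc n))) + sumTo n (λ j → ι (suc n C suc j) * (a (suc j) * b (suc n ∸ j)))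
      ≈⟨ +-congˡ (sumTo-extend _ (ℕ.n≤1+n n) beyond-n) ⟨
    ι 1 * (a 0 * b (suc (suc n))) + sumTo (suc n) (λ j → ι (suc n C suc j) * (a (suc j) * b (suc n ∸ j))) ∎
    where
    beyond-n : ∀ j → n < j → ι (suc n C suc j) * (a (suc j) * b (suc n ∸ j)) ≈ 0#
    beyond-n (suc j) n<j = x≈0⇒x*y≈0 _ (reflexive (≡.cong ι (k>n⇒nCk≡0 (s≤s n<j))))

  ⊛-D : ∀ a b → D (a ⊛ b) ≐ (D a ⊛ b) ⊕ (a ⊛ D b)
  ⊛-D a b n = begin
    (a ⊛ b) (suc n)
      ≈⟨ sumTo-suc n _ ⟩
    t₀ + sumTo n (λ j → ι (suc n C suc j) * A j)
      ≈⟨ +-congˡ (sumTo-cong n (λ j _ → pascal j)) ⟩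
    t₀ + sumTo n (λ j → ι (n C j) * A j + ι (n C suc j) * A j)
      ≈⟨ +-congˡ (sumTo-+ n _ _) ⟩
    t₀ + ((D a ⊛ b) n + sumTo n (λ j → ι (n C suc j) * A j))
      ≈⟨ x+[y+z]≈y+[x+z] _ _ _ ⟩
    (D a ⊛ b) n + (t₀ + sumTo n (λ j → ι (n C suc j) * A j))
      ≈⟨ +-congˡ (⊛-D-expand a b n) ⟨
    (D a ⊛ b) n + (a ⊛ D b) n ∎
    where
    t₀ = ι 1 * (a 0 * b (suc n))
    A : ℕ → Carrier
    A j = a (suc j) * b (n ∸ j)
    pascal : ∀ j → ι (suc n C suc j) * A j ≈ ι (n C j) * A j + ι (n C suc j) * A j
    pascal j = begin
      ι (suc n C suc j) * A j          ≡⟨ ≡.cong (λ i → ι i * A j) (nCk+nC[k+1]≡[n+1]C[k+1] n j) ⟨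
      ι (n C j ℕ.+ n C suc j) * A j    ≈⟨ *-congʳ (ι-+ (n C j) (n C suc j)) ⟩
      (ι (n C j) + ι (n C suc j)) * A j ≈⟨ distribʳ _ _ _ ⟩
      ι (n C j) * A j + ι (n C suc j) * A j ∎

  module _ (lam : Carrier) where

    u : Series
    u = eλ-1 lam

    -- (1 + λt) d/dt; since e_λ(t) = (1 + λt)^(1/λ), it sends e_λ(t) to itself
    Dλ : Series → Series
    Dλ a = D a ⊕ lam · θ a

    Dλ-leibniz : ∀ a b → Dλ (a ⊛ b) ≐ (Dλ a ⊛ b) ⊕ (a ⊛ Dλ b)
    Dλ-leibniz a b n = begin
      (a ⊛ b) (suc n) + lam * (ι n * (a ⊛ b) n)
        ≈⟨ +-cong (⊛-D a b n) (*-congˡ (θ-⊛ a b n)) ⟩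
      ((D a ⊛ b) n + (a ⊛ D b) n) + lam * ((θ a ⊛ b) n + (a ⊛ θ b) n)
        ≈⟨ solve 5 (λ p q r s l → (p :+ q) :+ l :* (r :+ s) := (p :+ l :* r) :+ (q :+ l :* s))
                 refl _ _ _ _ lam ⟩
      ((D a ⊛ b) n + lam * (θ a ⊛ b) n) + ((a ⊛ D b) n + lam * (a ⊛ θ b) n)
        ≈⟨ +-cong (+-congˡ (⊛-scaleˡ lam (θ a) b n)) (+-congˡ (⊛-scaleʳ lam a (θ b) n)) ⟨
      ((D a ⊛ b) n + (lam · θ a ⊛ b) n) + ((a ⊛ D b) n + (a ⊛ lam · θ b) n)
        ≈⟨ +-cong (⊛-distribʳ (D a) (lam · θ a) b n) (⊛-distribˡ a (D b) (lam · θ b) n) ⟨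
      (Dλ a ⊛ b) n + (a ⊛ Dλ b) n ∎

    Dλ-u : Dλ u ≐ oneS ⊕ u
    Dλ-u zero    = solve 1 (λ l → con (+ 1) :* (con (+ 1) :- con (+ 0) :* l) :+ l :* (con (+ 0) :* con (+ 0))
                                := con (+ 1) :+ con (+ 0)) refl lam
    Dλ-u (suc n) = solve 3 (λ l e k → e :* (con (+ 1) :- (con (+ 1) :+ k) :* l) :+ l :* ((con (+ 1) :+ k) :* e)
                                := con (+ 0) :+ e) refl lam (u (suc n)) (ι n)

    Dλ-oneS : ∀ n → Dλ oneS n ≈ 0#
    Dλ-oneS zero    = solve 1 (λ l → con (+ 0) :+ l :* (con (+ 0) :* con (+ 1)) := con (+ 0)) refl lam
    Dλ-oneS (suc n) = solve 2 (λ l k → con (+ 0) :+ l :* (k :* con (+ 0)) := con (+ 0)) refl lam (ι (suc n))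

    u⊛Dλ-powS : ∀ k → u ⊛ Dλ (powS u k) ≐ ι k · (powS u k ⊕ powS u (suc k))
    Dλ-powS   : ∀ k → Dλ (powS u (suc k)) ≐ ι (suc k) · (powS u k ⊕ powS u (suc k))

    u⊛Dλ-powS zero    n = trans (⊛-zeroʳ u Dλ-oneS n) (sym (zeroˡ _))
    u⊛Dλ-powS (suc k) n = begin
      (u ⊛ Dλ (powS u (suc k))) n
        ≈⟨ ⊛-congˡ u (Dλ-powS k) n ⟩
      (u ⊛ ι (suc k) · (powS u k ⊕ powS u (suc k))) n
        ≈⟨ ⊛-scaleʳ (ι (suc k)) u (powS u k ⊕ powS u (suc k)) n ⟩
      ι (suc k) * (u ⊛ (powS u k ⊕ powS u (suc k))) n
        ≈⟨ *-congˡ (⊛-distribˡ u (powS u k) (powS u (suc k)) n) ⟩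
      ι (suc k) * (powS u (suc k) n + powS u (suc (suc k)) n) ∎

    Dλ-powS k n = begin
      Dλ (u ⊛ powS u k) n
        ≈⟨ Dλ-leibniz u (powS u k) n ⟩
      (Dλ u ⊛ powS u k) n + (u ⊛ Dλ (powS u k)) n
        ≈⟨ +-cong (⊛-congʳ (powS u k) Dλ-u n) (u⊛Dλ-powS k n) ⟩
      ((oneS ⊕ u) ⊛ powS u k) n + ι k * (p + q)
        ≈⟨ +-congʳ (trans (⊛-distribʳ oneS u (powS u k) n) (+-congʳ (⊛-identityˡ (powS u k) n))) ⟩
      (p + q) + ι k * (p + q)
        ≈⟨ solve 2 (λ s k → s :+ k :* s := (con (+ 1) :+ k) :* s) refl (p + q) (ι k) ⟩
      ι (suc k) * (p + q) ∎
      where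
      p = powS u k n
      q = powS u (suc k) n

    -- (k+1)! times the recurrence S_λ(m+1, k+1) = S_λ(m, k) + (k+1 - mλ) S_λ(m, k+1)
    powS-recurrence : ∀ k m → powS u (suc k) (suc m)
                              ≈ ι (suc k) * powS u k m + (ι (suc k) - ι m * lam) * powS u (suc k) m
    powS-recurrence k m = begin
      x               ≈⟨ solve 2 (λ x y → x := x :+ y :- y) refl x (lam * (ι m * q)) ⟩
      Dλ (powS u (suc k)) m - lam * (ι m * q)
                      ≈⟨ +-congʳ (Dλ-powS k m) ⟩
      ι (suc k) * (p + q) - lam * (ι m * q)
                      ≈⟨ solve 5 (λ K p q m l → K :* (p :+ q) :- l :* (m :* q) := K :* p :+ (K :- m :* l) :* q)
                               refl (ι (suc k)) p q (ι m) lam ⟩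
      ι (suc k) * p + (ι (suc k) - ι m * lam) * q ∎
      where
      x = powS u (suc k) (suc m)
      p = powS u k m
      q = powS u (suc k) m

    powS-vanishes : ∀ {m k} → m < k → powS u k m ≈ 0#
    powS-vanishes {zero}  {suc k} _         = y≈0⇒x*y≈0 _ (zeroˡ _)
    powS-vanishes {suc m} {suc k} (s≤s m<k) = begin
      powS u (suc k) (suc m)
        ≈⟨ powS-recurrence k m ⟩
      ι (suc k) * powS u k m + (ι (suc k) - ι m * lam) * powS u (suc k) m
        ≈⟨ +-cong (*-congˡ (powS-vanishes m<k)) (*-congˡ (powS-vanishes (ℕ.m<n⇒m<1+n m<k))) ⟩
      ι (suc k) * 0# + (ι (suc k) - ι m * lam) * 0#
        ≈⟨ trans (+-cong (zeroʳ _) (zeroʳ _)) (+-identityʳ 0#) ⟩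
      0# ∎

    -- Σₖ c k · uᵏ, a finite sum in each coefficient because uᵏ = O(tᵏ)
    seriesInU : (ℕ → Carrier) → Series
    seriesInU c n = sumTo n (λ k → c k * powS u k n)

    seriesInU-extend : ∀ c {m n} → m ≤ n → seriesInU c m ≈ sumTo n (λ k → c k * powS u k m)
    seriesInU-extend c m≤n =
      sym (sumTo-extend _ m≤n (λ k m<k → y≈0⇒x*y≈0 (c k) (powS-vanishes m<k)))

    seriesInU-⊛u : ∀ c n → (seriesInU c ⊛ u) n ≈ sumTo n (λ k → c k * powS u (suc k) n)
    seriesInU-⊛u c n = begin
      (seriesInU c ⊛ u) n
        ≈⟨ ⊛-comm _ u n ⟩
      (u ⊛ seriesInU c) n
        ≈⟨ sumTo-cong n (λ j _ → *-congˡ (*-congˡ (seriesInU-extend c (ℕ.m∸n≤m n j)))) ⟩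
      (u ⊛ (λ m → sumTo n (λ k → c k * powS u k m))) n
        ≈⟨ ⊛-sumToʳ u n (λ k → c k · powS u k) n ⟩
      sumTo n (λ k → (u ⊛ c k · powS u k) n)
        ≈⟨ sumTo-cong n (λ k _ → ⊛-scaleʳ (c k) u (powS u k) n) ⟩
      sumTo n (λ k → c k * powS u (suc k) n) ∎

    binom*powS-recurrence : ∀ x k n →
      binom x (suc k) * powS u (suc k) (suc n)
        ≈ binom x k * (x - ι k) * powS u k n + (ι (suc k) - ι n * lam) * (binom x (suc k) * powS u (suc k) n)
    binom*powS-recurrence x k n = begin
      B * powS u (suc k) (suc n)
        ≈⟨ *-congˡ (powS-recurrence k n) ⟩
      B * (ι (suc k) * p + (ι (suc k) - ι n * lam) * q)
        ≈⟨ solve 5 (λ B K p N q → B :* (K :* p :+ N :* q) := K :* B :* p :+ N :* (B :* q))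
                 refl B (ι (suc k)) p (ι (suc k) - ι n * lam) q ⟩
      ι (suc k) * B * p + (ι (suc k) - ι n * lam) * (B * q)
        ≈⟨ +-congʳ (*-congʳ (binom-suc x k)) ⟩
      binom x k * (x - ι k) * p + (ι (suc k) - ι n * lam) * (B * q) ∎
      where
      B = binom x (suc k)
      p = powS u k n
      q = powS u (suc k) n

    seriesInU-binom-suc : ∀ x n → seriesInU (binom x) (suc n) ≈ (x - ι n * lam) * seriesInU (binom x) n
    seriesInU-binom-suc x n = begin
      sumTo (suc n) (λ k → binom x k * powS u k (suc n))
        ≈⟨ sumTo-suc n _ ⟩
      binom x 0 * 0# + sumTo n (λ k → binom x (suc k) * powS u (suc k) (suc n))
        ≈⟨ +-cong (zeroʳ _) (sumTo-cong n (λ k _ → binom*powS-recurrence x k n)) ⟩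
      0# + sumTo n (λ k → b k + g (suc k))
        ≈⟨ trans (+-identityˡ _) (sumTo-+ n b (g ∘ suc)) ⟩
      sumTo n b + sumTo n (g ∘ suc)
        ≈⟨ +-congˡ (trans (+-congʳ g[0]≈0) (+-identityˡ _)) ⟨
      sumTo n b + (g 0 + sumTo n (g ∘ suc))
        ≈⟨ +-congˡ (sumTo-shift n g[1+n]≈0) ⟩
      sumTo n b + sumTo n g
        ≈⟨ sumTo-+ n b g ⟨
      sumTo n (λ k → b k + g k)
        ≈⟨ sumTo-cong n (λ k _ → collect k) ⟩
      sumTo n (λ k → (x - ι n * lam) * (binom x k * powS u k n))
        ≈⟨ sumTo-*ˡ n _ _ ⟨
      (x - ι n * lam) * seriesInU (binom x) n ∎
      where
      b g : ℕ → Carrier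
      b k = binom x k * (x - ι k) * powS u k n
      g k = (ι k - ι n * lam) * (binom x k * powS u k n)

      g[0]≈0 : g 0 ≈ 0#
      g[0]≈0 = begin
        (0# - ι n * lam) * (binom x 0 * oneS n)
          ≈⟨ solve 4 (λ N l B δ → (con (+ 0) :- N :* l) :* (B :* δ) := (:- (l :* B)) :* (N :* δ))
                   refl (ι n) lam (binom x 0) (oneS n) ⟩
        - (lam * binom x 0) * (ι n * oneS n)
          ≈⟨ y≈0⇒x*y≈0 _ (θ-oneS n) ⟩
        0# ∎

      g[1+n]≈0 : g (suc n) ≈ 0#
      g[1+n]≈0 = y≈0⇒x*y≈0 _ (y≈0⇒x*y≈0 _ (powS-vanishes (ℕ.n<1+n n)))

      collect : ∀ k → b k + g k ≈ (x - ι n * lam) * (binom x k * powS u k n)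
      collect k = solve 6 (λ B X K N l p → B :* (X :- K) :* p :+ (K :- N :* l) :* (B :* p)
                                         := (X :- N :* l) :* (B :* p))
                        refl (binom x k) x (ι k) (ι n) lam (powS u k n)

    seriesInU-binom : ∀ x → seriesInU (binom x) ≐ fallλ lam x
    seriesInU-binom x zero    = trans (*-identityʳ _) (binom-zero x)
    seriesInU-binom x (suc n) = begin
      seriesInU (binom x) (suc n)        ≈⟨ seriesInU-binom-suc x n ⟩
      (x - ι n * lam) * seriesInU (binom x) n ≈⟨ *-congˡ (seriesInU-binom x n) ⟩
      (x - ι n * lam) * fallλ lam x n    ≈⟨ *-comm _ _ ⟩
      fallλ lam x n * (x - ι n * lam)    ∎

    fallλ-self : fallλ lam lam ≐ oneS ⊕ lam · tS
    fallλ-self zero          = solve 1 (λ l → con (+ 1) := con (+ 1) :+ l :* con (+ 0)) refl lam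
    fallλ-self (suc zero)    =
      solve 1 (λ l → con (+ 1) :* (l :- con (+ 0) :* l) := con (+ 0) :+ l :* con (+ 1)) refl lam
    fallλ-self (suc (suc n)) =
      trans (vanishes n) (solve 1 (λ l → con (+ 0) := con (+ 0) :+ l :* con (+ 0)) refl lam)
      where
      vanishes : ∀ n → fallλ lam lam (suc (suc n)) ≈ 0#
      vanishes zero    = solve 1 (λ l → con (+ 1) :* (l :- con (+ 0) :* l) :* (l :- (con (+ 1) :+ con (+ 0)) :* l)
                                      := con (+ 0)) refl lam
      vanishes (suc n) = x≈0⇒x*y≈0 _ (vanishes n)

    rhs-coefficient : ℕ → Carrier
    rhs-coefficient k = (- 1#) ^ k * (binomλ lam k * ι (suc k) ⁻¹)

    rhs≐seriesInU : rhs lam ≐ seriesInU rhs-coefficient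
    rhs≐seriesInU n = sumTo-cong n (λ k _ → begin
      (- 1#) ^ k * (ι (k !) * ((ι (k !) ⁻¹ * powS u k n) * h k))
        ≈⟨ *-congˡ (*-assoc _ _ _) ⟨
      (- 1#) ^ k * (ι (k !) * (ι (k !) ⁻¹ * powS u k n) * h k)
        ≈⟨ *-congˡ (*-congʳ (x[x⁻¹y]≈y (ι[n!]≉0 k) _)) ⟩
      (- 1#) ^ k * (powS u k n * h k)
        ≈⟨ x∙yz≈xz∙y _ _ _ ⟩
      rhs-coefficient k * powS u k n ∎)
      where
      h : ℕ → Carrier
      h k = binomλ lam k * ι (suc k) ⁻¹

    lam*rhs-coefficient : ∀ k → lam * rhs-coefficient k ≈ binom lam (suc k)
    lam*rhs-coefficient k = *-cancelˡ (char0 k) (begin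
      ι (suc k) * (lam * ((- 1#) ^ k * (binomλ lam k * ι (suc k) ⁻¹)))
        ≈⟨ solve 5 (λ K l s B K⁻¹ → K :* (l :* (s :* (B :* K⁻¹))) := l :* (s :* B :* (K :* K⁻¹)))
                 refl (ι (suc k)) lam ((- 1#) ^ k) (binomλ lam k) (ι (suc k) ⁻¹) ⟩
      lam * ((- 1#) ^ k * binomλ lam k * (ι (suc k) * ι (suc k) ⁻¹))
        ≈⟨ *-congˡ (*-cong (binom-negate-upper lam k) (inverseʳ _ (char0 k))) ⟩
      lam * (binom (lam - 1#) k * 1#)
        ≈⟨ *-congˡ (*-identityʳ _) ⟩
      lam * binom (lam - 1#) k
        ≈⟨ binom-absorb lam k ⟨
      ι (suc k) * binom lam (suc k) ∎)

    rhs-isDegBernoulli : ¬ lam ≈ 0# → IsDegBernoulli lam (rhs lam)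
    rhs-isDegBernoulli lam≉0 n = *-cancelˡ lam≉0 (+-cancelˡ (oneS n) _ _ (begin
      oneS n + lam * (rhs lam ⊛ u) n
        ≈⟨ +-congˡ (*-congˡ (trans (⊛-congʳ u rhs≐seriesInU n) (seriesInU-⊛u rhs-coefficient n))) ⟩
      oneS n + lam * sumTo n (λ k → rhs-coefficient k * powS u (suc k) n)
        ≈⟨ +-cong (sym (trans (*-congʳ (binom-zero lam)) (*-identityˡ _)))
                  (trans (sumTo-*ˡ n lam _) (sumTo-cong n (λ k _ →
                     trans (sym (*-assoc _ _ _)) (*-congʳ (lam*rhs-coefficient k))))) ⟩
      binom lam 0 * powS u 0 n + sumTo n (λ k → binom lam (suc k) * powS u (suc k) n)
        ≈⟨ sumTo-shift n (y≈0⇒x*y≈0 _ (powS-vanishes (ℕ.n<1+n n))) ⟩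
      seriesInU (binom lam) n
        ≈⟨ seriesInU-binom lam n ⟩
      fallλ lam lam n
        ≈⟨ fallλ-self n ⟩
      oneS n + lam * tS n ∎))

    u[1]≈1 : u 1 ≈ 1#
    u[1]≈1 = solve 1 (λ l → con (+ 1) :* (con (+ 1) :- con (+ 0) :* l) := con (+ 1)) refl lam

    ⊛u-leading : ∀ {d} m → (∀ {i} → i < m → d i ≈ 0#) → (d ⊛ u) (suc m) ≈ ι (suc m) * d m
    ⊛u-leading {d} m d<m≈0 = begin
      (d ⊛ u) (suc m)                        ≈⟨ sumTo-single (suc m) _ (ℕ.n≤1+n m) other-terms ⟩
      ι (suc m C m) * (d m * u (suc m ∸ m))
        ≡⟨ ≡.cong₂ (λ i j → ι i * (d m * u j)) [1+m]Cm≡1+m (ℕ.m+n∸n≡m 1 m) ⟩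
      ι (suc m) * (d m * u 1)                ≈⟨ *-congˡ (trans (*-congˡ u[1]≈1) (*-identityʳ _)) ⟩
      ι (suc m) * d m                        ∎
      where
      [1+m]Cm≡1+m : suc m C m ≡ suc m
      [1+m]Cm≡1+m = ≡.trans (nCk≡nC[n∸k] (ℕ.n≤1+n m))
                            (≡.trans (≡.cong (suc m C_) (ℕ.m+n∸n≡m 1 m)) (nC1≡n (suc m)))

      other-terms : ∀ j → j ≤ suc m → j ≢ m → ι (suc m C j) * (d j * u (suc m ∸ j)) ≈ 0#
      other-terms j j≤1+m j≢m with ℕ.m≤n⇒m<n∨m≡n j≤1+m
      ... | inj₁ j<1+m  = y≈0⇒x*y≈0 _ (x≈0⇒x*y≈0 _ (d<m≈0 (ℕ.≤∧≢⇒< (ℕ.≤-pred j<1+m) j≢m)))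
      ... | inj₂ ≡.refl = y≈0⇒x*y≈0 _ (y≈0⇒x*y≈0 _ (reflexive (≡.cong u (ℕ.n∸n≡0 m))))

    ⊛u≈0⇒≈0 : ∀ {d} → (∀ n → (d ⊛ u) n ≈ 0#) → ∀ n → d n ≈ 0#
    ⊛u≈0⇒≈0 {d} d⊛u≈0 = <-rec _ λ m d<m≈0 → *-cancelˡ (char0 m) (begin
      ι (suc m) * d m  ≈⟨ ⊛u-leading m d<m≈0 ⟨
      (d ⊛ u) (suc m)  ≈⟨ d⊛u≈0 (suc m) ⟩
      0#               ≈⟨ zeroʳ _ ⟨
      ι (suc m) * 0#   ∎)

    ⊛u-injective : ∀ {a b} → a ⊛ u ≐ b ⊛ u → a ≐ b
    ⊛u-injective {a} {b} a⊛u≐b⊛u n = x∙y⁻¹≈ε⇒x≈y (a n) (b n) (begin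
      a n - b n                ≈⟨ +-congˡ (-1*x≈-x (b n)) ⟨
      (a ⊕ (- 1#) · b) n       ≈⟨ ⊛u≈0⇒≈0 difference⊛u≈0 n ⟩
      0#                       ∎)
      where
      difference⊛u≈0 : ∀ n → ((a ⊕ (- 1#) · b) ⊛ u) n ≈ 0#
      difference⊛u≈0 n = begin
        ((a ⊕ (- 1#) · b) ⊛ u) n          ≈⟨ ⊛-distribʳ a ((- 1#) · b) u n ⟩
        (a ⊛ u) n + ((- 1#) · b ⊛ u) n    ≈⟨ +-cong (a⊛u≐b⊛u n) (⊛-scaleˡ (- 1#) b u n) ⟩
        (b ⊛ u) n + - 1# * (b ⊛ u) n
          ≈⟨ solve 1 (λ x → x :+ :- con (+ 1) :* x := con (+ 0)) refl ((b ⊛ u) n) ⟩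
        0#                                ∎

theorem2p1 : ∀ {c ℓ} (F : CharZeroField c ℓ) →
    let open CharZeroField F
        open Degenerate F
    in (lam : Carrier) → ¬ (lam ≈ 0#) →
       (β : ℕ → Carrier) → IsDegBernoulli lam β →
       (n : ℕ) → β n ≈ rhs lam n
theorem2p1 F lam lam≉0 β β-isDegBernoulli =
  ⊛u-injective lam (λ n → trans (β-isDegBernoulli n) (sym (rhs-isDegBernoulli lam lam≉0 n)))
  where
  open CharZeroField F using (trans; sym)
  open DegenerateSeries F
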